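{- Let $p\in\mathbb{Z}_{\ge0}$ and let $s$ be a positive integer. Then $i\oplus s=i+s$ for all $i=0,1,\dots,p$ if and only if there exist a positive integer $u$ and a nonnegative integer $v$ such that $s=u\cdot2^v$ and $2^v>p$.
   Context: $\oplus$ denotes nim-sum (bitwise XOR of binary expansions). -}

module Defs where

open import Data.Nat using (ℕ; zero; suc; _+_; _*_; _^_)
open import Data.Nat.DivMod using (_/_; _%_)
open import Data.Nat.Properties using (m^n≢0)

bit : ℕ → ℕ → ℕ
bit m k = (_/_ m (2 ^ k) {{m^n≢0 2 k}}) % 2

xorBit : ℕ → ℕ → ℕ
xorBit a b = (a + b) % 2

nimSumUpTo : ℕ → ℕ → ℕ → ℕ
nimSumUpTo zero    m n = 0
nimSumUpTo (suc k) m n = nimSumUpTo k m n + 2 ^ k * xorBit (bit m k) (bit n k)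

-- nim-sum m ⊕ n : bitwise XOR of binary expansions.
-- All digits of m and n at positions ≥ m + n are 0 (since 2^(m+n) > m, n),
-- so summing over positions k < m + n gives the full XOR.
_⊕_ : ℕ → ℕ → ℕ
m ⊕ n = nimSumUpTo (m + n) m n

infixl 6 _⊕_

-- Digitwise a + b = (a XOR b) + 2 (a AND b), so m ⊕ n + 2 (m AND n) = m + n and m ⊕ n = m + n
-- exactly when m and n have no binary digit in common. Write s = u 2^v with u odd: s has no digit
-- below position v and has digit v, so every i < 2^v is digit-disjoint from s, while i = 2^v
-- shares digit v with s; hence the condition holds for all i ≤ p iff 2^v > p.

module Submission where

open import Defs
open import Data.Nat
  using (ℕ; zero; suc; _+_; _*_; _^_; _≤_; _<_; _>_; z≤n; s≤s; s≤s⁻¹; NonZero; _<?_)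
open import Data.Nat.Properties
open import Data.Nat.DivMod
open import Data.Nat.Divisibility using (n∣m*n)
open import Data.Nat.Induction using (<-rec)
open import Data.Nat.Solver using (module +-*-Solver)
open import Data.Fin using (zero; suc)
open import Data.Product using (Σ; _×_; _,_)
open import Function.Bundles using (_⇔_; mk⇔; module Equivalence)
open import Relation.Binary.PropositionalEquality
open import Relation.Nullary using (¬_; yes; no; contradiction)
open +-*-Solver using (solve; _:+_; _:*_; con; _:=_)

m%[n*o]≡m%o+m/o%n*o : ∀ m n o .{{_ : NonZero n}} .{{_ : NonZero o}} {{_ : NonZero (n * o)}} →
                      m % (n * o) ≡ m % o + m / o % n * o
m%[n*o]≡m%o+m/o%n*o m n o = begin
  m % (n * o)                           ≡⟨ m≡m%n+[m/n]*n (m % (n * o)) o ⟩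
  m % (n * o) % o + m % (n * o) / o * o ≡⟨ cong₂ (λ a b → a + b * o)
                                             (m∣n⇒o%n%m≡o%m o (n * o) m (n∣m*n n))
                                             (m%[n*o]/o≡m/o%n m n o) ⟩
  m % o + m / o % n * o                 ∎
  where open ≡-Reasoning

n<2^n : ∀ n → n < 2 ^ n
n<2^n zero    = s≤s z≤n
n<2^n (suc n) = +-mono-≤ (m^n>0 2 n) (≤-trans (n<2^n n) (m≤m+n (2 ^ n) 0))

m<2^[m+n] : ∀ m n → m < 2 ^ (m + n)
m<2^[m+n] m n = <-≤-trans (n<2^n m) (^-monoʳ-≤ 2 (m≤m+n m n))

n<2^[m+n] : ∀ m n → n < 2 ^ (m + n)
n<2^[m+n] m n = <-≤-trans (n<2^n n) (^-monoʳ-≤ 2 (m≤n+m n m))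

_%2^_ : ℕ → ℕ → ℕ
m %2^ k = _%_ m (2 ^ k) {{m^n≢0 2 k}}

%2^-suc : ∀ m k → m %2^ suc k ≡ m %2^ k + bit m k * 2 ^ k
%2^-suc m k = m%[n*o]≡m%o+m/o%n*o m 2 (2 ^ k) {{_}} {{m^n≢0 2 k}} {{m^n≢0 2 (suc k)}}

m<2^k⇒m%2^k≡m : ∀ {m} k → m < 2 ^ k → m %2^ k ≡ m
m<2^k⇒m%2^k≡m k = m<n⇒m%n≡m {{m^n≢0 2 k}}

bit<2 : ∀ m k → bit m k < 2
bit<2 m k = m%n<n (m / 2 ^ k) 2
  where instance _ = m^n≢0 2 k

m<2^k⇒bit[m,k]≡0 : ∀ {m} k → m < 2 ^ k → bit m k ≡ 0
m<2^k⇒bit[m,k]≡0 k m<2^k = cong (_% 2) (m<n⇒m/n≡0 {{m^n≢0 2 k}} m<2^k)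

xorBit+2*∧≡+ : ∀ {a b} → a < 2 → b < 2 → xorBit a b + 2 * (a * b) ≡ a + b
xorBit+2*∧≡+ {0} {0} _ _ = refl
xorBit+2*∧≡+ {0} {1} _ _ = refl
xorBit+2*∧≡+ {1} {0} _ _ = refl
xorBit+2*∧≡+ {1} {1} _ _ = refl
xorBit+2*∧≡+ {suc (suc _)} (s≤s (s≤s ()))
xorBit+2*∧≡+ {_} {suc (suc _)} _ (s≤s (s≤s ()))

bitAndUpTo : ℕ → ℕ → ℕ → ℕ
bitAndUpTo zero    m n = 0
bitAndUpTo (suc k) m n = bitAndUpTo k m n + 2 ^ k * (bit m k * bit n k)

nimSumUpTo+2*bitAndUpTo : ∀ k m n → nimSumUpTo k m n + 2 * bitAndUpTo k m n ≡ m %2^ k + n %2^ k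
nimSumUpTo+2*bitAndUpTo zero    m n = sym (cong₂ _+_ (n%1≡0 m) (n%1≡0 n))
nimSumUpTo+2*bitAndUpTo (suc k) m n = begin
  (X + P * xorBit a b) + 2 * (A + P * (a * b))   ≡⟨ solve 6 (λ X A P x a b →
      (X :+ P :* x) :+ con 2 :* (A :+ P :* (a :* b)) := (X :+ con 2 :* A) :+ P :* (x :+ con 2 :* (a :* b)))
      refl X A P (xorBit a b) a b ⟩
  (X + 2 * A) + P * (xorBit a b + 2 * (a * b))   ≡⟨ cong₂ (λ l d → l + P * d)
                                                      (nimSumUpTo+2*bitAndUpTo k m n)
                                                      (xorBit+2*∧≡+ (bit<2 m k) (bit<2 n k)) ⟩
  (m %2^ k + n %2^ k) + P * (a + b)               ≡⟨ solve 5 (λ M N P a b →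
      (M :+ N) :+ P :* (a :+ b) := (M :+ a :* P) :+ (N :+ b :* P)) refl (m %2^ k) (n %2^ k) P a b ⟩
  (m %2^ k + a * P) + (n %2^ k + b * P)           ≡⟨ sym (cong₂ _+_ (%2^-suc m k) (%2^-suc n k)) ⟩
  m %2^ suc k + n %2^ suc k                       ∎
  where
  open ≡-Reasoning
  X = nimSumUpTo k m n
  A = bitAndUpTo k m n
  P = 2 ^ k
  a = bit m k
  b = bit n k

⊕+2*bitAnd≡+ : ∀ m n → m ⊕ n + 2 * bitAndUpTo (m + n) m n ≡ m + n
⊕+2*bitAnd≡+ m n = begin
  m ⊕ n + 2 * bitAndUpTo (m + n) m n  ≡⟨ nimSumUpTo+2*bitAndUpTo (m + n) m n ⟩
  m %2^ (m + n) + n %2^ (m + n)       ≡⟨ cong₂ _+_ (m<2^k⇒m%2^k≡m (m + n) (m<2^[m+n] m n))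
                                                   (m<2^k⇒m%2^k≡m (m + n) (n<2^[m+n] m n)) ⟩
  m + n                               ∎
  where open ≡-Reasoning

BitsDisjoint : ℕ → ℕ → Set
BitsDisjoint m n = ∀ j → bit m j * bit n j ≡ 0

disjoint⇒bitAndUpTo≡0 : ∀ {m n} → BitsDisjoint m n → ∀ k → bitAndUpTo k m n ≡ 0
disjoint⇒bitAndUpTo≡0 disj zero    = refl
disjoint⇒bitAndUpTo≡0 disj (suc k) rewrite disjoint⇒bitAndUpTo≡0 disj k | disj k = *-zeroʳ (2 ^ k)

2^j*bitAnd≤bitAndUpTo : ∀ {j k} m n → j < k → 2 ^ j * (bit m j * bit n j) ≤ bitAndUpTo k m n
2^j*bitAnd≤bitAndUpTo {j} {suc k} m n j<1+k with j <? k
... | yes j<k = ≤-trans (2^j*bitAnd≤bitAndUpTo m n j<k) (m≤m+n _ _)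
... | no  j≮k rewrite ≤-antisym (s≤s⁻¹ j<1+k) (≮⇒≥ j≮k) = m≤n+m _ _

bitAndUpTo≡0⇒disjoint : ∀ {m n} → bitAndUpTo (m + n) m n ≡ 0 → BitsDisjoint m n
bitAndUpTo≡0⇒disjoint {m} {n} A≡0 j with j <? m + n
... | yes j<m+n = m*n≡0⇒m≡0 (bit m j * bit n j) (2 ^ j) {{m^n≢0 2 j}} (trans (*-comm _ (2 ^ j))
                    (n≤0⇒n≡0 (subst (2 ^ j * (bit m j * bit n j) ≤_) A≡0 (2^j*bitAnd≤bitAndUpTo m n j<m+n))))
... | no  j≮m+n = cong (_* bit n j)
                    (m<2^k⇒bit[m,k]≡0 j (<-≤-trans (m<2^[m+n] m n) (^-monoʳ-≤ 2 (≮⇒≥ j≮m+n))))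

⊕≡+⇔disjoint : ∀ m n → (m ⊕ n ≡ m + n) ⇔ BitsDisjoint m n
⊕≡+⇔disjoint m n = mk⇔ to from
  where
  A = bitAndUpTo (m + n) m n
  to : m ⊕ n ≡ m + n → BitsDisjoint m n
  to eq = bitAndUpTo≡0⇒disjoint (*-cancelˡ-≡ A 0 2 (+-cancelˡ-≡ (m ⊕ n) _ _
            (trans (⊕+2*bitAnd≡+ m n) (trans (sym eq) (sym (+-identityʳ _))))))
  from : BitsDisjoint m n → m ⊕ n ≡ m + n
  from disj = begin
    m ⊕ n             ≡⟨ sym (+-identityʳ _) ⟩
    m ⊕ n + 2 * 0     ≡⟨ cong (λ a → m ⊕ n + 2 * a) (sym (disjoint⇒bitAndUpTo≡0 disj (m + n))) ⟩
    m ⊕ n + 2 * A     ≡⟨ ⊕+2*bitAnd≡+ m n ⟩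
    m + n             ∎
    where open ≡-Reasoning

bit[m*2^k]k≡m%2 : ∀ m k → bit (m * 2 ^ k) k ≡ m % 2
bit[m*2^k]k≡m%2 m k = cong (_% 2) (m*n/n≡m m (2 ^ k) {{m^n≢0 2 k}})

bit[m*2^k]j≡0 : ∀ m {j k} → j < k → bit (m * 2 ^ k) j ≡ 0
bit[m*2^k]j≡0 m {j} j<k with m≤n⇒∃[o]m+o≡n j<k
... | d , refl = begin
  bit (m * 2 ^ (suc j + d)) j       ≡⟨ cong (λ e → bit (m * e) j) (^-distribˡ-+-* 2 (suc j) d) ⟩
  bit (m * (2 * 2 ^ j * 2 ^ d)) j   ≡⟨ cong (λ e → bit e j) (solve 3 (λ m J D →
                                         m :* (con 2 :* J :* D) := m :* D :* con 2 :* J) refl m (2 ^ j) (2 ^ d)) ⟩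
  bit (m * 2 ^ d * 2 * 2 ^ j) j     ≡⟨ bit[m*2^k]k≡m%2 (m * 2 ^ d * 2) j ⟩
  m * 2 ^ d * 2 % 2                 ≡⟨ m*n%n≡0 (m * 2 ^ d) 2 ⟩
  0                                 ∎
  where open ≡-Reasoning

0<n⇒∃[w,v]n≡[1+w*2]*2^v : ∀ n → 0 < n → Σ ℕ λ w → Σ ℕ λ v → n ≡ (1 + w * 2) * 2 ^ v
0<n⇒∃[w,v]n≡[1+w*2]*2^v = <-rec _ split
  where
  split : ∀ n → (∀ {m} → m < n → 0 < m → Σ ℕ λ w → Σ ℕ λ v → m ≡ (1 + w * 2) * 2 ^ v) →
          0 < n → Σ ℕ λ w → Σ ℕ λ v → n ≡ (1 + w * 2) * 2 ^ v
  split n rec 0<n with n divMod 2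
  ... | result w (suc zero) n≡1+w*2 = w , 0 , trans n≡1+w*2 (sym (*-identityʳ _))
  ... | result zero zero refl = contradiction 0<n (<-irrefl refl)
  ... | result q@(suc _) zero refl with rec (m<m*n q 2 (s≤s (s≤s z≤n))) (s≤s z≤n)
  ...   | w , v , q≡ = w , suc v , (begin
    q * 2                         ≡⟨ cong (_* 2) q≡ ⟩
    (1 + w * 2) * 2 ^ v * 2       ≡⟨ solve 2 (λ u P → u :* P :* con 2 := u :* (con 2 :* P)) refl (1 + w * 2) (2 ^ v) ⟩
    (1 + w * 2) * 2 ^ suc v       ∎)
    where open ≡-Reasoning

mainTheorem15 : (p s : ℕ) → s > 0 →
    ((∀ i → i ≤ p → i ⊕ s ≡ i + s) ⇔
     Σ ℕ (λ u → Σ ℕ (λ v → u > 0 × s ≡ u * 2 ^ v × 2 ^ v > p)))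
mainTheorem15 p s s>0 = mk⇔ to from
  where
  to : (∀ i → i ≤ p → i ⊕ s ≡ i + s) → Σ ℕ (λ u → Σ ℕ (λ v → u > 0 × s ≡ u * 2 ^ v × 2 ^ v > p))
  to noCarry with 0<n⇒∃[w,v]n≡[1+w*2]*2^v s s>0
  ... | w , v , s≡ = 1 + w * 2 , v , s≤s z≤n , s≡ , ≰⇒> 2^v≰p
    where
    bit-s-v : bit s v ≡ 1
    bit-s-v = trans (cong (λ e → bit e v) s≡)
                (trans (bit[m*2^k]k≡m%2 (1 + w * 2) v) ([m+kn]%n≡m%n 1 w 2))
    bit-2^v-v : bit (2 ^ v) v ≡ 1
    bit-2^v-v = trans (cong (λ e → bit e v) (sym (*-identityˡ (2 ^ v)))) (bit[m*2^k]k≡m%2 1 v)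
    2^v≰p : ¬ (2 ^ v ≤ p)
    2^v≰p 2^v≤p = contradiction
      (trans (sym (cong₂ _*_ bit-2^v-v bit-s-v)) (Equivalence.to (⊕≡+⇔disjoint (2 ^ v) s) (noCarry (2 ^ v) 2^v≤p) v))
      λ ()
  from : Σ ℕ (λ u → Σ ℕ (λ v → u > 0 × s ≡ u * 2 ^ v × 2 ^ v > p)) → (∀ i → i ≤ p → i ⊕ s ≡ i + s)
  from (u , v , _ , refl , 2^v>p) i i≤p = Equivalence.from (⊕≡+⇔disjoint i (u * 2 ^ v)) disjoint
    where
    disjoint : BitsDisjoint i (u * 2 ^ v)
    disjoint j with j <? v
    ... | yes j<v = trans (cong (bit i j *_) (bit[m*2^k]j≡0 u j<v)) (*-zeroʳ (bit i j))
    ... | no  j≮v = cong (_* bit (u * 2 ^ v) j)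
                      (m<2^k⇒bit[m,k]≡0 j (<-≤-trans (≤-<-trans i≤p 2^v>p) (^-monoʳ-≤ 2 (≮⇒≥ j≮v))))
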